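{- Let $G=(V,E)$ be an undirected graph and let $k$ be a positive integer. If $W\subseteq V$ is a vertex cover of $G$ and $|W|\leq k$, then for every sequence $w_1,\ldots,w_k$ that enumerates all elements in $W$ (possibly with repetitions), $M = D_{vc}(G,k) \cup \{vc(i,w_i)\colon i=1,\ldots, k\}$ is a model of the data-program pair $(D_{vc}(G,k), P_{vc})$. Conversely, if $M$ is a model of $(D_{vc}(G,k),P_{vc})$ then the set $W=\{w\in V\colon vc(i,w)\in M \text{ for some } i=1,\ldots,k\}$ is a vertex cover of $G$ with $|W|\leq k$.
   Context: Setting (logic PS): a rule is a formula $A_1\wedge\ldots\wedge A_m \rightarrow B_1\vee\ldots\vee B_n$ whose free variables are implicitly universally quantified; atoms in the consequent may contain the underscore symbol `_`, each occurrence standing for an existentially quantified variable (e.g. $vc(\_,X)$ stands for $\exists W\, vc(W,X)$). A data-program pair $(D,P)$ consists of a finite set $D$ of ground atoms (data) and a finite set $P$ of rules (program). A set $M$ of ground atoms is a model of $(D,P)$ if it is a Herbrand model (over the constants appearing in $D\cup P$) of $cl(D)\cup P$, where $cl(D)$ contains $\top\rightarrow p(t)$ for every $p(t)\in D$ and $p(t)\rightarrow\bot$ for every other ground atom $p(t)$ whose relation symbol $p$ occurs in $D$ (closed-world assumption). Predefined relations such as equality are interpreted with their intended meaning, and their ground atoms are omitted when describing models. A set $W\subseteq V$ is a vertex cover of $G$ if every edge $\{x,y\}\in E$ has $x\in W$ or $y\in W$. Vertex cover encoding: $D_{vc}(G,k) = \{vtx(v)\colon v\in V\} \cup \{edge(v,w)\colon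 \{v,w\}\in E\} \cup \{index(i)\colon i=1,\ldots, k\}$. The program $P_{vc}$ consists of the rules VC1: $vc(I,X) \rightarrow vtx(X)$; VC2: $vc(I,X)\rightarrow index(I)$; VC3: $index(I)\rightarrow vc(I,\_)$; VC4: $vc(I,X) \wedge vc(I,Y) \rightarrow X=Y$; VC5: $edge(X,Y) \rightarrow vc(\_,X) \vee vc(\_,Y)$. -}

module Defs where

open import Data.Nat using (ℕ; _≤_)
open import Data.Fin using (Fin)
open import Data.Fin.Subset using (Subset; _∈_; ∣_∣)
open import Data.Bool using (Bool; true; false; T; _∨_)
open import Data.Sum using (_⊎_; inj₁; inj₂)
open import Data.Product using (Σ; ∃; _×_; _,_)
open import Data.List.Base using (allFin)
open import Data.Bool.ListAction using (any)
open import Data.Vec using (tabulate)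
open import Relation.Binary.PropositionalEquality using (_≡_)
open import Relation.Nullary using (¬_)
open import Data.Fin using (_≟_)
open import Relation.Nullary.Decidable using (⌊_⌋)

record Graph : Set where
  field
    n     : ℕ
    E     : Fin n → Fin n → Bool
    sym   : ∀ x y → E x y ≡ E y x
    loopless : ∀ x → E x x ≡ false
open Graph public

IsVertexCover : (G : Graph) → Subset (n G) → Set
IsVertexCover G W = ∀ x y → T (E G x y) → x ∈ W ⊎ y ∈ W

-- Herbrand universe: the constants occurring in D_vc(G,k) ∪ P_vc,
-- i.e. the vertices (inj₁ v) and the indices 1..k (inj₂ i, i : Fin k
-- standing for index i+1).  P_vc contains no constants.

Const : ℕ → ℕ → Set
Const n k = Fin n ⊎ Fin k

-- Relation symbols (equality is predefined and not an atom).
data RelSym : Set where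
  vtxˢ edgeˢ indexˢ vcˢ : RelSym

data Atom (n k : ℕ) : Set where
  vtx   : Const n k → Atom n k
  edge  : Const n k → Const n k → Atom n k
  index : Const n k → Atom n k
  vc    : Const n k → Const n k → Atom n k

symOf : ∀ {n k} → Atom n k → RelSym
symOf (vtx _)    = vtxˢ
symOf (edge _ _) = edgeˢ
symOf (index _)  = indexˢ
symOf (vc _ _)   = vcˢ

-- A set of ground atoms (the Herbrand base is finite, so sets of
-- ground atoms are given by their characteristic functions).
AtomSet : ℕ → ℕ → Set
AtomSet n k = Atom n k → Bool

_∈ᴹ_ : ∀ {n k} → Atom n k → AtomSet n k → Set
a ∈ᴹ M = T (M a)

Dvc : (G : Graph) (k : ℕ) → AtomSet (n G) k
Dvc G k (vtx (inj₁ v))             = true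
Dvc G k (vtx (inj₂ _))             = false
Dvc G k (edge (inj₁ v) (inj₁ w))   = E G v w
Dvc G k (edge _ _)                 = false
Dvc G k (index (inj₁ _))           = false
Dvc G k (index (inj₂ i))           = true
Dvc G k (vc _ _)                   = false

-- M is a Herbrand model of cl(D):
--  every atom of D is in M, and every other ground atom whose relation
--  symbol occurs in D is not in M (closed-world assumption).

OccursIn : ∀ {n k} → RelSym → AtomSet n k → Set
OccursIn {n} {k} r D = ∃ λ (b : Atom n k) → b ∈ᴹ D × symOf b ≡ r

ModelOfCl : ∀ {n k} → AtomSet n k → AtomSet n k → Set
ModelOfCl {n} {k} D M =
  (∀ (a : Atom n k) → a ∈ᴹ D → a ∈ᴹ M) ×
  (∀ (a : Atom n k) → OccursIn (symOf a) D → ¬ (a ∈ᴹ D) → ¬ (a ∈ᴹ M))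

-- Satisfaction of the rules of P_vc by M (variables range over the
-- Herbrand universe; "_" is existentially quantified over it).
module _ {n k : ℕ} (M : AtomSet n k) where
  VC1 VC2 VC3 VC4 VC5 : Set
  VC1 = ∀ I X → vc I X ∈ᴹ M → vtx X ∈ᴹ M
  VC2 = ∀ I X → vc I X ∈ᴹ M → index I ∈ᴹ M
  VC3 = ∀ I → index I ∈ᴹ M → ∃ λ W → vc I W ∈ᴹ M
  VC4 = ∀ I X Y → vc I X ∈ᴹ M → vc I Y ∈ᴹ M → X ≡ Y
  VC5 = ∀ X Y → edge X Y ∈ᴹ M →
          (∃ λ W → vc W X ∈ᴹ M) ⊎ (∃ λ W → vc W Y ∈ᴹ M)

Program : ℕ → ℕ → Set₁
Program n k = AtomSet n k → Set

Pvc : ∀ {n k} → Program n k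
Pvc M = VC1 M × VC2 M × VC3 M × VC4 M × VC5 M

IsModel : ∀ {n k} → AtomSet n k → Program n k → AtomSet n k → Set
IsModel D P M = ModelOfCl D M × P M

-- M = D_vc(G,k) ∪ {vc(i,w_i) : i = 1..k}

withVC : (G : Graph) (k : ℕ) → (Fin k → Fin (n G)) → AtomSet (n G) k
withVC G k w (vc (inj₂ i) (inj₁ v)) = ⌊ w i ≟ v ⌋
withVC G k w a                      = Dvc G k a

-- W = {w ∈ V : vc(i,w) ∈ M for some i = 1..k}
coverOf : (G : Graph) (k : ℕ) → AtomSet (n G) k → Subset (n G)
coverOf G k M = tabulate λ v → any (λ i → M (vc (inj₂ i) (inj₁ v))) (allFin k)

{-# OPTIONS --safe #-}
-- The vc atoms of D_vc(G,k) ∪ {vc(i,w_i)} form the graph of the function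
-- i ↦ w_i, which gives VC1–VC4 outright; VC5 says exactly that the image of w
-- covers every edge. Conversely, in any model VC5 places an endpoint of each
-- edge in W, and VC4 makes "an index i with vc(i,v) ∈ M" an injection from W
-- into the k indices, so |W| ≤ k.
module Submission where

open import Defs hiding (sym)
open import Data.Nat using (ℕ; _≤_; zero; suc; z≤n; s≤s)
open import Data.Fin using (Fin; zero; suc; punchOut)
open import Data.Fin.Properties using (punchOut-injective; suc-injective)
open import Data.Fin.Subset using (Subset; _∈_; ∣_∣; inside; outside)
open import Data.Product using (∃; _×_; _,_; proj₁; proj₂)
open import Data.Sum using (_⊎_; inj₁; inj₂)
import Data.Sum as Sum
open import Data.Sum.Properties using (inj₁-injective)
open import Data.Bool using (Bool; T)
open import Data.Bool.Properties using (T-≡)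
open import Data.Unit using (tt)
open import Data.Empty using (⊥-elim)
open import Data.Vec using (_∷_; []; tabulate; here; there)
open import Data.Vec.Properties using (lookup⇒[]=; []=⇒lookup; lookup∘tabulate)
open import Data.List.Base using (allFin)
open import Data.List.Relation.Unary.Any using (satisfied)
open import Data.List.Relation.Unary.Any.Properties using (any⁺; any⁻)
open import Data.List.Membership.Propositional using (lose)
open import Data.List.Membership.Propositional.Properties using (∈-allFin)
open import Function using (_∘_; _⇔_; mk⇔; Equivalence)
open import Relation.Binary.PropositionalEquality using (_≡_; _≢_; refl; trans; sym; subst)
open import Relation.Nullary using (¬_)
open import Relation.Nullary.Decidable using (toWitness; fromWitness)

injective⇒∣p∣≤ : ∀ {m k} (p : Subset m) (f : ∀ v → v ∈ p → Fin k) →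
                 (∀ u v u∈p v∈p → f u u∈p ≡ f v v∈p → u ≡ v) → ∣ p ∣ ≤ k
injective⇒∣p∣≤ [] f f-inj = z≤n
injective⇒∣p∣≤ (outside ∷ p) f f-inj =
  injective⇒∣p∣≤ p (λ v v∈p → f (suc v) (there v∈p))
    (λ u v u∈p v∈p eq → suc-injective (f-inj (suc u) (suc v) _ _ eq))
injective⇒∣p∣≤ {k = zero} (inside ∷ p) f f-inj with f zero here
... | ()
injective⇒∣p∣≤ {k = suc k} (inside ∷ p) f f-inj =
  s≤s (injective⇒∣p∣≤ p f′ f′-inj)
  where
  f0≢f-suc : ∀ v v∈p → f zero here ≢ f (suc v) (there v∈p)
  f0≢f-suc v v∈p eq with f-inj zero (suc v) _ _ eq
  ... | ()

  f′ : ∀ v → v ∈ p → Fin k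
  f′ v v∈p = punchOut (f0≢f-suc v v∈p)

  f′-inj : ∀ u v u∈p v∈p → f′ u u∈p ≡ f′ v v∈p → u ≡ v
  f′-inj u v u∈p v∈p eq = suc-injective
    (f-inj (suc u) (suc v) _ _ (punchOut-injective (f0≢f-suc u u∈p) (f0≢f-suc v v∈p) eq))

∈-tabulate⇔ : ∀ {m} {f : Fin m → Bool} {v} → v ∈ tabulate f ⇔ T (f v)
∈-tabulate⇔ {f = f} {v} = mk⇔
  (Equivalence.from T-≡ ∘ trans (sym (lookup∘tabulate f v)) ∘ []=⇒lookup)
  (lookup⇒[]= v (tabulate f) ∘ trans (lookup∘tabulate f v) ∘ Equivalence.to T-≡)

CoversEdges : (G : Graph) → (Fin (n G) → Set) → Set
CoversEdges G P = ∀ x y → T (E G x y) → P x ⊎ P y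

¬vcˢ-occurs-in-Dvc : ∀ {G k} → ¬ OccursIn vcˢ (Dvc G k)
¬vcˢ-occurs-in-Dvc (vtx _ , _ , ())
¬vcˢ-occurs-in-Dvc (edge _ _ , _ , ())
¬vcˢ-occurs-in-Dvc (index _ , _ , ())
¬vcˢ-occurs-in-Dvc (vc _ _ , () , _)

module _ (G : Graph) (k : ℕ) (w : Fin k → Fin (n G)) where

  withVC-vc⁻ : ∀ I X → vc I X ∈ᴹ withVC G k w → ∃ λ i → I ≡ inj₂ i × X ≡ inj₁ (w i)
  withVC-vc⁻ (inj₁ _) _        ()
  withVC-vc⁻ (inj₂ _) (inj₂ _) ()
  withVC-vc⁻ (inj₂ i) (inj₁ v) h with toWitness h
  ... | refl = i , refl , refl

  Dvc⊆withVC : ∀ a → a ∈ᴹ Dvc G k → a ∈ᴹ withVC G k w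
  Dvc⊆withVC (vtx _)    a∈D = a∈D
  Dvc⊆withVC (edge _ _) a∈D = a∈D
  Dvc⊆withVC (index _)  a∈D = a∈D
  Dvc⊆withVC (vc _ _)   ()

  withVC-closed : ∀ a → OccursIn (symOf a) (Dvc G k) → ¬ a ∈ᴹ Dvc G k → ¬ a ∈ᴹ withVC G k w
  withVC-closed (vtx _)    _      a∉D = a∉D
  withVC-closed (edge _ _) _      a∉D = a∉D
  withVC-closed (index _)  _      a∉D = a∉D
  withVC-closed (vc _ _)   vcˢ∈D _  = ⊥-elim (¬vcˢ-occurs-in-Dvc vcˢ∈D)

  withVC-isModel : CoversEdges G (λ v → ∃ λ i → w i ≡ v) → IsModel (Dvc G k) Pvc (withVC G k w)
  withVC-isModel covers = (Dvc⊆withVC , withVC-closed) , vc1 , vc2 , vc3 , vc4 , vc5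
    where
    M = withVC G k w

    vc1 : VC1 M
    vc1 I X h with withVC-vc⁻ I X h
    ... | _ , refl , refl = tt

    vc2 : VC2 M
    vc2 I X h with withVC-vc⁻ I X h
    ... | _ , refl , refl = tt

    vc3 : VC3 M
    vc3 (inj₂ i) _ = inj₁ (w i) , fromWitness refl

    vc4 : VC4 M
    vc4 I X Y hX hY with withVC-vc⁻ I X hX | withVC-vc⁻ I Y hY
    ... | _ , refl , refl | _ , refl , refl = refl

    chosen : ∀ {v} → ∃ (λ i → w i ≡ v) → ∃ λ I → vc I (inj₁ v) ∈ᴹ M
    chosen (i , wi≡v) = inj₂ i , fromWitness wi≡v

    vc5 : VC5 M
    vc5 (inj₁ x) (inj₁ y) e = Sum.map chosen chosen (covers x y e)

module _ {G : Graph} {k : ℕ} {M : AtomSet (n G) k} where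

  ∈-coverOf⇔ : ∀ {v} → v ∈ coverOf G k M ⇔ ∃ λ i → vc (inj₂ i) (inj₁ v) ∈ᴹ M
  ∈-coverOf⇔ = mk⇔
    (satisfied ∘ any⁻ _ (allFin k) ∘ Equivalence.to ∈-tabulate⇔)
    (Equivalence.from ∈-tabulate⇔ ∘ any⁺ _ ∘ λ (i , h) → lose (∈-allFin i) h)

  ∣coverOf∣≤k : VC4 M → ∣ coverOf G k M ∣ ≤ k
  ∣coverOf∣≤k vc4 = injective⇒∣p∣≤ (coverOf G k M) (λ _ → proj₁ ∘ indexOf) indexOf-injective
    where
    indexOf : ∀ {v} → v ∈ coverOf G k M → ∃ λ i → vc (inj₂ i) (inj₁ v) ∈ᴹ M
    indexOf = Equivalence.to ∈-coverOf⇔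

    indexOf-injective : ∀ u v u∈W v∈W → proj₁ (indexOf u∈W) ≡ proj₁ (indexOf v∈W) → u ≡ v
    indexOf-injective u v u∈W v∈W eq = inj₁-injective (vc4 _ _ _ (proj₂ (indexOf u∈W))
      (subst (λ i → vc (inj₂ i) (inj₁ v) ∈ᴹ M) (sym eq) (proj₂ (indexOf v∈W))))

  -- The closed-world assumption excludes index(v) for a vertex v only because
  -- k ≥ 1 makes the relation symbol index occur in D_vc(G,k).
  vc-index : 1 ≤ k → ModelOfCl (Dvc G k) M → VC2 M → ∀ {I X} → vc I X ∈ᴹ M → ∃ λ i → I ≡ inj₂ i
  vc-index (s≤s _) (_ , closed) vc2 {inj₁ v} {X} h =
    ⊥-elim (closed (index (inj₁ v)) (index (inj₂ zero) , tt , refl) (λ ()) (vc2 _ X h))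
  vc-index _ _ _ {inj₂ i} _ = i , refl

  coverOf-isVertexCover : 1 ≤ k → IsModel (Dvc G k) Pvc M → IsVertexCover G (coverOf G k M)
  coverOf-isVertexCover k≥1 (cl@(D⊆M , _) , _ , vc2 , _ , _ , vc5) x y e =
    Sum.map covered covered (vc5 _ _ (D⊆M (edge (inj₁ x) (inj₁ y)) e))
    where
    covered : ∀ {v} → ∃ (λ I → vc I (inj₁ v) ∈ᴹ M) → v ∈ coverOf G k M
    covered (_ , h) with vc-index k≥1 cl vc2 h
    ... | i , refl = Equivalence.from ∈-coverOf⇔ (i , h)

proposition3 : (G : Graph) (k : ℕ) → 1 ≤ k →
    ((W : Subset (n G)) → IsVertexCover G W → ∣ W ∣ ≤ k →
    (w : Fin k → Fin (n G)) →
    (∀ i → w i ∈ W) → (∀ v → v ∈ W → ∃ λ i → w i ≡ v) →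
    IsModel (Dvc G k) Pvc (withVC G k w))
    ×
    ((M : AtomSet (n G) k) → IsModel (Dvc G k) Pvc M →
    IsVertexCover G (coverOf G k M) × ∣ coverOf G k M ∣ ≤ k)
proposition3 G k k≥1 =
  (λ W cover _ w _ onto → withVC-isModel G k w (λ x y → Sum.map (onto x) (onto y) ∘ cover x y)) ,
  λ { M model@(_ , _ , _ , _ , vc4 , _) → coverOf-isVertexCover k≥1 model , ∣coverOf∣≤k {G} {M = M} vc4 }
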